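{- Given a finite temporal Heyting algebra $A$, $(\mathsf{P}\text{ - }\mathrm{Filt}(A),\subseteq)\cong(\mathsf{P}\text{ - }\mathrm{Com}(A),\geq)$ as posets, via $F\mapsto\bigwedge F$ and $a\mapsto{\uparrow}a$.
   Context: Write $\mathsf{P}$ for the "past diamond" operator (black diamond). A temporal Heyting algebra is a Heyting algebra with operators $\Box,\mathsf{P}$ such that $\Box(a\wedge b)=\Box a\wedge\Box b$, $a\le\Box a$, $\Box a\le b\vee(b\to a)$, and $\mathsf{P}a\le b\iff a\le\Box b$. $\mathsf{P}\text{ - }\mathrm{Filt}(A)$ is the set of filters $F$ such that $a\to b\in F$ implies $\mathsf{P}a\to\mathsf{P}b\in F$. $\mathsf{P}\text{ - }\mathrm{Com}(A)$ is the set of elements $a$ with $a\wedge\mathsf{P}b\le\mathsf{P}(a\wedge b)$ for all $b$. -}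

module Defs where

open import Level using (Level; _⊔_; suc)
open import Data.Nat using (ℕ)
open import Data.Fin using (Fin)
import Data.Fin.Properties as FinP
open import Data.List using (List; foldr; allFin)
open import Data.Product using (Σ; _×_; _,_)
open import Relation.Nullary using (Dec; yes; no; ¬_)
open import Relation.Unary using (Pred; Decidable; _⊆_)
import Relation.Binary
open import Relation.Binary using (Rel)
import Relation.Binary.Definitions as BD
open import Relation.Binary.PropositionalEquality as ≡ using (_≡_)
open import Relation.Binary.Lattice.Bundles using (HeytingAlgebra)
import Relation.Binary.Lattice.Properties.MeetSemilattice as MSP
open import Function.Bundles using (Inverse)

record TemporalHeytingAlgebra c ℓ₁ ℓ₂ : Set (suc (c ⊔ ℓ₁ ⊔ ℓ₂)) where
  field
    heytingAlgebra : HeytingAlgebra c ℓ₁ ℓ₂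
  open HeytingAlgebra heytingAlgebra public
  field
    □         : Carrier → Carrier
    P         : Carrier → Carrier
    □-∧       : ∀ a b → □ (a ∧ b) ≈ (□ a ∧ □ b)
    ≤-□       : ∀ a → a ≤ □ a
    □-≤-∨⇨    : ∀ a b → □ a ≤ (b ∨ (b ⇨ a))
    P⊣□       : ∀ a b → (P a ≤ b → a ≤ □ b) × (a ≤ □ b → P a ≤ b)

record FiniteTHA c ℓ₁ ℓ₂ : Set (suc (c ⊔ ℓ₁ ⊔ ℓ₂)) where
  field
    tha     : TemporalHeytingAlgebra c ℓ₁ ℓ₂
  open TemporalHeytingAlgebra tha public
  field
    size    : ℕ
    finite  : Inverse setoid (≡.setoid (Fin size))

module FiniteTHAOps {c ℓ₁ ℓ₂} (A : FiniteTHA c ℓ₁ ℓ₂) where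
  open FiniteTHA A public
  open Inverse finite using (to; from; to-cong; inverseʳ)
  module Eqv = Relation.Binary.Setoid setoid

  _≈?_ : BD.Decidable _≈_
  x ≈? y with to x FinP.≟ to y
  ... | yes e = yes (Eqv.trans (Eqv.sym (inverseʳ ≡.refl))
                       (Eqv.trans (≡.subst (λ i → from i ≈ y) (≡.sym e) (inverseʳ ≡.refl)) Eqv.refl))
  ... | no ne = no (λ x≈y → ne (to-cong x≈y))

  _≤?_ : BD.Decidable _≤_
  _≤?_ = MSP.≈-dec⇒≤-dec meetSemilattice _≈?_

  record Subset : Set (c ⊔ suc ℓ₂) where
    field
      mem  : Pred Carrier ℓ₂
      mem? : Decidable mem
  open Subset public

  _⊑_ : Subset → Subset → Set (c ⊔ ℓ₂)
  F ⊑ G = mem F ⊆ mem G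

  _≐_ : Subset → Subset → Set (c ⊔ ℓ₂)
  F ≐ G = (F ⊑ G) × (G ⊑ F)

  ↑ : Carrier → Subset
  ↑ a = record { mem = λ x → a ≤ x ; mem? = λ x → a ≤? x }

  ⋀ : Subset → Carrier
  ⋀ F = foldr step ⊤ (allFin size)
    where
    step : Fin size → Carrier → Carrier
    step i acc with mem? F (from i)
    ... | yes _ = from i ∧ acc
    ... | no  _ = acc

  record IsFilter (F : Subset) : Set (c ⊔ ℓ₂) where
    field
      ⊤∈    : mem F ⊤
      ∧-closed : ∀ {a b} → mem F a → mem F b → mem F (a ∧ b)
      up-closed : ∀ {a b} → mem F a → a ≤ b → mem F b

  record IsPFilter (F : Subset) : Set (c ⊔ ℓ₂) where
    field
      isFilter : IsFilter F
      P-closed : ∀ a b → mem F (a ⇨ b) → mem F (P a ⇨ P b)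

  IsPCom : Carrier → Set (c ⊔ ℓ₂)
  IsPCom a = ∀ b → (a ∧ P b) ≤ P (a ∧ b)

-- In a finite Heyting algebra every filter F is principal, generated by the
-- meet ⋀F of its elements, so F ↦ ⋀F and a ↦ ↑a are mutually inverse and
-- order-reversing between filters and elements. Under this correspondence
-- closure of ↑a under  a ⇨ b ↦ P a ⇨ P b  is exactly the inequality
-- a ∧ P b ≤ P (a ∧ b): one direction uses b ⇨ (a ∧ b) ∈ ↑a, the other the
-- monotonicity of the left adjoint P.
module Submission where

open import Defs
open import Data.Product using (_×_; _,_; proj₁; proj₂)
open import Data.List using ([]; _∷_; foldr; allFin)
open import Data.List.Relation.Unary.Any using (here; there)
open import Data.List.Membership.Propositional using (_∈_)
open import Data.List.Membership.Propositional.Properties using (∈-allFin)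
open import Data.Fin using (Fin)
open import Data.Empty using (⊥-elim)
open import Relation.Nullary using (yes; no)
open import Function.Bundles using (Inverse)
import Relation.Binary.PropositionalEquality as ≡
open ≡ using (_≡_)

module _ {c ℓ₁ ℓ₂} (A : FiniteTHA c ℓ₁ ℓ₂) where
  open FiniteTHAOps A
  open Inverse finite using (from; to; inverseʳ)

  -- ⋀ F folds a step function local to its definition; unifying against
  -- ⋀ F by refl recovers that function so that the fold can be analysed.
  private
    stepOf : ∀ F {s : Fin size → Carrier → Carrier} →
             foldr s ⊤ (allFin size) ≡ ⋀ F → Fin size → Carrier → Carrier
    stepOf F {s} _ = s

    step : Subset → Fin size → Carrier → Carrier
    step F = stepOf F ≡.refl

    fold-greatest : ∀ F {x} → (∀ {y} → mem F y → x ≤ y) →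
                    ∀ is → x ≤ foldr (step F) ⊤ is
    fold-greatest F lb []       = maximum _
    fold-greatest F lb (i ∷ is) with mem? F (from i)
    ... | yes i∈F = ∧-greatest (lb i∈F) (fold-greatest F lb is)
    ... | no  _   = fold-greatest F lb is

    fold-lowerBound : ∀ F {i} → mem F (from i) →
                      ∀ {is} → i ∈ is → foldr (step F) ⊤ is ≤ from i
    fold-lowerBound F i∈F {i ∷ _} (here ≡.refl) with mem? F (from i)
    ... | yes _   = x∧y≤x _ _
    ... | no  i∉F = ⊥-elim (i∉F i∈F)
    fold-lowerBound F i∈F {j ∷ _} (there i∈is) with mem? F (from j)
    ... | yes _ = trans (x∧y≤y _ _) (fold-lowerBound F i∈F i∈is)
    ... | no  _ = fold-lowerBound F i∈F i∈is

    fold-∈ : ∀ {F} → IsFilter F → ∀ is → mem F (foldr (step F) ⊤ is)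
    fold-∈ F-filter []       = IsFilter.⊤∈ F-filter
    fold-∈ {F} F-filter (i ∷ is) with mem? F (from i)
    ... | yes i∈F = IsFilter.∧-closed F-filter i∈F (fold-∈ F-filter is)
    ... | no  _   = fold-∈ F-filter is

  ⋀-greatest : ∀ F {x} → (∀ {y} → mem F y → x ≤ y) → x ≤ ⋀ F
  ⋀-greatest F lb = fold-greatest F lb (allFin size)

  ⋀-lowerBound : ∀ {F} → IsFilter F → ∀ {x} → mem F x → ⋀ F ≤ x
  ⋀-lowerBound {F} F-filter {x} x∈F =
    trans (fold-lowerBound F from-to-x∈F (∈-allFin (to x))) (reflexive from-to-x≈x)
    where
    from-to-x≈x : from (to x) ≈ x
    from-to-x≈x = inverseʳ ≡.refl

    from-to-x∈F : mem F (from (to x))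
    from-to-x∈F = IsFilter.up-closed F-filter x∈F (reflexive (Eq.sym from-to-x≈x))

  ⋀-∈ : ∀ {F} → IsFilter F → mem F (⋀ F)
  ⋀-∈ F-filter = fold-∈ F-filter (allFin size)

  ↑⋀-≐ : ∀ {F} → IsFilter F → ↑ (⋀ F) ≐ F
  ↑⋀-≐ F-filter = IsFilter.up-closed F-filter (⋀-∈ F-filter) , ⋀-lowerBound F-filter

  ↑-isFilter : ∀ a → IsFilter (↑ a)
  ↑-isFilter a = record { ⊤∈ = maximum a ; ∧-closed = ∧-greatest ; up-closed = trans }

  ⋀↑-≈ : ∀ a → ⋀ (↑ a) ≈ a
  ⋀↑-≈ a = antisym (⋀-lowerBound (↑-isFilter a) refl) (⋀-greatest (↑ a) (λ a≤y → a≤y))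

  ↑-antitone : ∀ {a b} → b ≤ a → ↑ a ⊑ ↑ b
  ↑-antitone b≤a a≤x = trans b≤a a≤x

  ↑-reflects-≥ : ∀ {a b} → ↑ a ⊑ ↑ b → b ≤ a
  ↑-reflects-≥ ↑a⊑↑b = ↑a⊑↑b refl

  ⋀-antitone : ∀ {F G} → IsFilter F → IsFilter G → F ⊑ G → ⋀ G ≤ ⋀ F
  ⋀-antitone F-filter G-filter F⊑G = ⋀-lowerBound G-filter (F⊑G (⋀-∈ F-filter))

  ⋀-reflects-≥ : ∀ {F G} → IsFilter F → IsFilter G → ⋀ G ≤ ⋀ F → F ⊑ G
  ⋀-reflects-≥ F-filter G-filter ⋀G≤⋀F x∈F =
    IsFilter.up-closed G-filter (⋀-∈ G-filter) (trans ⋀G≤⋀F (⋀-lowerBound F-filter x∈F))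

  P-mono : ∀ {a b} → a ≤ b → P a ≤ P b
  P-mono {a} {b} a≤b = proj₂ (P⊣□ a (P b)) (trans a≤b (proj₁ (P⊣□ b (P b)) refl))

  PFilter⇒PCom-⋀ : ∀ {F} → IsPFilter F → IsPCom (⋀ F)
  PFilter⇒PCom-⋀ {F} F-pfilter b = transpose-∧ (⋀-lowerBound F-filter Pb⇨P[a∧b]∈F)
    where
    F-filter = IsPFilter.isFilter F-pfilter
    a = ⋀ F

    b⇨[a∧b]∈F : mem F (b ⇨ (a ∧ b))
    b⇨[a∧b]∈F = IsFilter.up-closed F-filter (⋀-∈ F-filter) (transpose-⇨ refl)

    Pb⇨P[a∧b]∈F : mem F (P b ⇨ P (a ∧ b))
    Pb⇨P[a∧b]∈F = IsPFilter.P-closed F-pfilter b (a ∧ b) b⇨[a∧b]∈F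

  PCom⇒PFilter-↑ : ∀ {a} → IsPCom a → IsPFilter (↑ a)
  PCom⇒PFilter-↑ {a} a-PCom = record
    { isFilter = ↑-isFilter a
    ; P-closed = λ x y a≤x⇨y →
        transpose-⇨ (trans (a-PCom x) (P-mono (transpose-∧ a≤x⇨y)))
    }

corollary3p18 : ∀ {c ℓ₁ ℓ₂} (A : FiniteTHA c ℓ₁ ℓ₂) →
    let open FiniteTHAOps A in
    (∀ F → IsPFilter F → IsPCom (⋀ F))
    × (∀ a → IsPCom a → IsPFilter (↑ a))
    × (∀ F → IsPFilter F → ↑ (⋀ F) ≐ F)
    × (∀ a → IsPCom a → ⋀ (↑ a) ≈ a)
    × (∀ F G → IsPFilter F → IsPFilter G → (F ⊑ G → ⋀ G ≤ ⋀ F) × (⋀ G ≤ ⋀ F → F ⊑ G))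
    × (∀ a b → IsPCom a → IsPCom b → (b ≤ a → ↑ a ⊑ ↑ b) × (↑ a ⊑ ↑ b → b ≤ a))
corollary3p18 A =
    (λ _ → PFilter⇒PCom-⋀ A)
  , (λ _ → PCom⇒PFilter-↑ A)
  , (λ _ F-pfilter → ↑⋀-≐ A (filter F-pfilter))
  , (λ a _ → ⋀↑-≈ A a)
  , (λ _ _ F-pfilter G-pfilter →
         ⋀-antitone A (filter F-pfilter) (filter G-pfilter)
       , ⋀-reflects-≥ A (filter F-pfilter) (filter G-pfilter))
  , (λ _ _ _ _ → ↑-antitone A , ↑-reflects-≥ A)
  where
  open FiniteTHAOps A using (IsFilter; IsPFilter)

  filter : ∀ {F} → IsPFilter F → IsFilter F
  filter = IsPFilter.isFilter
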